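{- If $\mathbb{Z}$ is definable in the field $\mathbb{Q}$ by an existential first-order formula in the language of rings $\{+,\cdot;0,1\}$, then $\mathbb{Z}$ is also definable in $\mathbb{Q}$ by a universal first-order formula in the language of rings. -}

module Defs where

open import Data.Nat using (ℕ; suc)
open import Data.Fin using (Fin; zero; suc)
open import Data.Integer using (ℤ)
open import Data.Rational using (ℚ; _+_; _*_; 0ℚ; 1ℚ; _/_)
open import Data.Product using (Σ; _×_)
open import Data.Sum using (_⊎_)
open import Relation.Nullary using (¬_)
open import Relation.Binary.PropositionalEquality using (_≡_)
open import Function.Bundles using (_⇔_)

data Term (n : ℕ) : Set where
  var  : Fin n → Term n
  zer  : Term n
  one  : Term n
  _⊕_  : Term n → Term n → Term n
  _⊗_  : Term n → Term n → Term n

data QF (n : ℕ) : Set where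
  _≐_  : Term n → Term n → QF n
  ¬'_  : QF n → QF n
  _∧'_ : QF n → QF n → QF n
  _∨'_ : QF n → QF n → QF n

evalT : ∀ {n} → Term n → (Fin n → ℚ) → ℚ
evalT (var i) ρ = ρ i
evalT zer ρ = 0ℚ
evalT one ρ = 1ℚ
evalT (s ⊕ t) ρ = evalT s ρ + evalT t ρ
evalT (s ⊗ t) ρ = evalT s ρ * evalT t ρ

Sat : ∀ {n} → QF n → (Fin n → ℚ) → Set
Sat (s ≐ t) ρ = evalT s ρ ≡ evalT t ρ
Sat (¬' φ) ρ = ¬ Sat φ ρ
Sat (φ ∧' ψ) ρ = Sat φ ρ × Sat ψ ρ
Sat (φ ∨' ψ) ρ = Sat φ ρ ⊎ Sat ψ ρ

-- Assignment: variable 0 is the free variable x, variables 1..m are the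
-- quantified ones.
cons : ∀ {m} → ℚ → (Fin m → ℚ) → Fin (suc m) → ℚ
cons q ys zero = q
cons q ys (suc i) = ys i

ExistentiallyDefinable : (ℚ → Set) → Set
ExistentiallyDefinable S =
  Σ ℕ λ m → Σ (QF (suc m)) λ φ →
    ∀ q → S q ⇔ Σ (Fin m → ℚ) (λ ys → Sat φ (cons q ys))

UniversallyDefinable : (ℚ → Set) → Set
UniversallyDefinable S =
  Σ ℕ λ m → Σ (QF (suc m)) λ φ →
    ∀ q → S q ⇔ ((ys : Fin m → ℚ) → Sat φ (cons q ys))

IsInteger : ℚ → Set
IsInteger q = Σ ℤ λ z → q ≡ z / 1

module Submission where

-- A rational q fails to be an integer exactly when it is a "proper
-- fraction": q = a/b for integers a, b with a·u + b·v = 1 for some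
-- integers u, v (so a and b are coprime) and b² ≠ 1.  Hence
--
--   q ∈ ℤ  ⇔  ¬ ∃ a b u v ∈ ℤ. q·b = a ∧ a·u + b·v = 1 ∧ b·b ≠ 1.

open import Data.Nat as ℕ using (ℕ; zero; suc)
import Data.Nat.Properties as ℕP
open import Data.Nat.GCD using (module Bézout)
open import Data.Nat.Coprimality using (coprime-Bézout; recompute)
open import Data.Integer as ℤ using (ℤ; +_; -[1+_]; 1ℤ)
import Data.Integer.Properties as ℤP
open import Data.Integer.Tactic.RingSolver using (solve)
open import Data.List using ([]; _∷_)
open import Data.Rational using (ℚ; mkℚ; _+_; _*_; 1ℚ; _/_; toℚᵘ; ↥_; ↧ₙ_)
open import Data.Rational.Properties using (toℚᵘ-injective; toℚᵘ-fromℚᵘ; toℚᵘ-homo-*; toℚᵘ-homo-+; toℚᵘ-cong)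
open import Data.Rational.Unnormalised as ℚᵘ using (mkℚᵘ; *≡*; _≃_)
import Data.Rational.Unnormalised.Properties as ℚᵘP
open import Data.Fin using (Fin; zero; suc; _↑ˡ_; _↑ʳ_; combine)
open import Data.Fin.Patterns using (0F; 1F; 2F; 3F; 4F)
open import Data.Fin.Properties using (remQuot-combine)
open import Data.Vec.Functional using (Vector; concat) renaming (_++_ to _++ᵛ_; [] to []ᵛ; _∷_ to _∷ᵛ_)
open import Data.Vec.Functional.Properties using (lookup-++ˡ; lookup-++ʳ)
open import Data.Product using (Σ; ∃₂; _,_; _×_; proj₁; proj₂; uncurry)
open import Data.Product.Function.NonDependent.Propositional using (_×-⇔_)
open import Data.Sum.Function.Propositional using (_⊎-⇔_)
open import Data.Empty using (⊥-elim)
open import Function using (_∘_)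
open import Function.Bundles using (_⇔_; mk⇔; Equivalence)
import Function.Properties.Equivalence as ⇔
open import Function.Related.TypeIsomorphisms using (¬-cong-⇔)
open import Relation.Nullary using (¬_; yes; no)
open import Relation.Binary.PropositionalEquality using (_≡_; _≢_; refl; sym; trans; cong; cong₂; module ≡-Reasoning)

open import Defs

open Equivalence using (to; from)

ι : ℤ → ℚ
ι z = z / 1

-- ι z is represented by the unnormalised fraction z/1; this is how all
-- computations with ι are reduced to integer arithmetic.
toℚᵘ-ι : ∀ z → toℚᵘ (ι z) ≃ mkℚᵘ z 0
toℚᵘ-ι z = toℚᵘ-fromℚᵘ (mkℚᵘ z 0)

≃-ι : ∀ {p} z → toℚᵘ p ≃ mkℚᵘ z 0 → p ≡ ι z
≃-ι z p≃z = toℚᵘ-injective (ℚᵘP.≃-trans p≃z (ℚᵘP.≃-sym (toℚᵘ-ι z)))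

ι-+ : ∀ a b → ι a + ι b ≡ ι (a ℤ.+ b)
ι-+ a b = ≃-ι (a ℤ.+ b) (begin
  toℚᵘ (ι a + ι b)            ≈⟨ toℚᵘ-homo-+ (ι a) (ι b) ⟩
  toℚᵘ (ι a) ℚᵘ.+ toℚᵘ (ι b)  ≈⟨ ℚᵘP.+-cong (toℚᵘ-ι a) (toℚᵘ-ι b) ⟩
  mkℚᵘ a 0 ℚᵘ.+ mkℚᵘ b 0      ≈⟨ *≡* cross ⟩
  mkℚᵘ (a ℤ.+ b) 0            ∎)
  where
  open ℚᵘP.≃-Reasoning
  cross : (a ℤ.* 1ℤ ℤ.+ b ℤ.* 1ℤ) ℤ.* 1ℤ ≡ (a ℤ.+ b) ℤ.* 1ℤ
  cross = solve (a ∷ b ∷ [])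

ι-* : ∀ a b → ι a * ι b ≡ ι (a ℤ.* b)
ι-* a b = ≃-ι (a ℤ.* b) (begin
  toℚᵘ (ι a * ι b)            ≈⟨ toℚᵘ-homo-* (ι a) (ι b) ⟩
  toℚᵘ (ι a) ℚᵘ.* toℚᵘ (ι b)  ≈⟨ ℚᵘP.*-cong (toℚᵘ-ι a) (toℚᵘ-ι b) ⟩
  mkℚᵘ (a ℤ.* b) 0            ∎)
  where open ℚᵘP.≃-Reasoning

ι-injective : ∀ {a b} → ι a ≡ ι b → a ≡ b
ι-injective {a} {b} ιa≡ιb
  with *≡* a*1≡b*1 ← ℚᵘP.≃-trans (ℚᵘP.≃-sym (toℚᵘ-ι a)) (ℚᵘP.≃-trans (toℚᵘ-cong ιa≡ιb) (toℚᵘ-ι b))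
  = trans (sym (ℤP.*-identityʳ a)) (trans a*1≡b*1 (ℤP.*-identityʳ b))

ι-bézout : ∀ a b u v → ι a * ι u + ι b * ι v ≡ ι (a ℤ.* u ℤ.+ b ℤ.* v)
ι-bézout a b u v = trans (cong₂ _+_ (ι-* a u) (ι-* b v)) (ι-+ (a ℤ.* u) (b ℤ.* v))

-- An integer with a multiplicative inverse is ±1, so squares to 1.
unit-square : ∀ b c → b ℤ.* c ≡ 1ℤ → b ℤ.* b ≡ 1ℤ
unit-square b c bc≡1 =
  abs-one b (ℕP.m*n≡1⇒m≡1 ℤ.∣ b ∣ ℤ.∣ c ∣ (trans (sym (ℤP.abs-* b c)) (cong ℤ.∣_∣ bc≡1)))
  where
  abs-one : ∀ b → ℤ.∣ b ∣ ≡ 1 → b ℤ.* b ≡ 1ℤ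
  abs-one (+ .1)    refl = refl
  abs-one -[1+ 0 ]  _    = refl

-- Soundness of the fraction test: if x·b = a and a·u + b·v = 1 in ℤ, then
-- b·(x·u + v) = 1, so b = ±1.
integral-fraction-unit : ∀ x a b u v →
  x ℤ.* b ≡ a → a ℤ.* u ℤ.+ b ℤ.* v ≡ 1ℤ → b ℤ.* b ≡ 1ℤ
integral-fraction-unit x .(x ℤ.* b) b u v refl au+bv≡1 =
  unit-square b (x ℤ.* u ℤ.+ v) (begin
    b ℤ.* (x ℤ.* u ℤ.+ v)          ≡⟨ solve (x ∷ b ∷ u ∷ v ∷ []) ⟩
    x ℤ.* b ℤ.* u ℤ.+ b ℤ.* v      ≡⟨ au+bv≡1 ⟩
    1ℤ                             ∎)
  where open ≡-Reasoning

rearrange-bézout : ∀ m d x y → x ℤ.* m ≡ 1ℤ ℤ.+ y ℤ.* d → m ℤ.* x ℤ.+ d ℤ.* ℤ.- y ≡ 1ℤ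
rearrange-bézout m d x y xm≡1+yd = begin
  m ℤ.* x ℤ.+ d ℤ.* ℤ.- y        ≡⟨ solve (m ∷ d ∷ x ∷ y ∷ []) ⟩
  x ℤ.* m ℤ.- y ℤ.* d            ≡⟨ cong (ℤ._- y ℤ.* d) xm≡1+yd ⟩
  1ℤ ℤ.+ y ℤ.* d ℤ.- y ℤ.* d     ≡⟨ solve (d ∷ y ∷ []) ⟩
  1ℤ                             ∎
  where open ≡-Reasoning

lift-bézout : ∀ m d x y → 1 ℕ.+ y ℕ.* d ≡ x ℕ.* m → + x ℤ.* + m ≡ 1ℤ ℤ.+ + y ℤ.* + d
lift-bézout m d x y eq = begin
  + x ℤ.* + m          ≡⟨ ℤP.pos-* x m ⟨
  + (x ℕ.* m)          ≡⟨ cong +_ eq ⟨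
  + (1 ℕ.+ y ℕ.* d)    ≡⟨ cong (λ k → 1ℤ ℤ.+ k) (ℤP.pos-* y d) ⟩
  1ℤ ℤ.+ + y ℤ.* + d   ∎
  where open ≡-Reasoning

-- Bézout's identity in ℤ for coprime m, d, from the library's ℕ-version
-- (which comes in two sign patterns).
bézout-ℤ : ∀ m d → Bézout.Identity 1 m d → ∃₂ λ u v → + m ℤ.* u ℤ.+ + d ℤ.* v ≡ 1ℤ
bézout-ℤ m d (Bézout.+- x y eq) = + x , ℤ.- + y , rearrange-bézout (+ m) (+ d) (+ x) (+ y) (lift-bézout m d x y eq)
bézout-ℤ m d (Bézout.-+ x y eq) = ℤ.- + x , + y ,
  trans (ℤP.+-comm (+ m ℤ.* ℤ.- + x) (+ d ℤ.* + y))
        (rearrange-bézout (+ d) (+ m) (+ y) (+ x) (lift-bézout d m y x eq))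

numerator-denominator-bézout : ∀ q → ∃₂ λ u v → ↥ q ℤ.* u ℤ.+ + ↧ₙ q ℤ.* v ≡ 1ℤ
numerator-denominator-bézout (mkℚ (+ n)    d c) = bézout-ℤ n (suc d) (coprime-Bézout (recompute c))
numerator-denominator-bézout (mkℚ -[1+ n ] d c)
  with u , v , eq ← bézout-ℤ (suc n) (suc d) (coprime-Bézout (recompute c))
  = ℤ.- u , v , trans (cong (ℤ._+ _) (neg-*-neg (+ suc n) u)) eq
  where
  neg-*-neg : ∀ i j → ℤ.- i ℤ.* ℤ.- j ≡ i ℤ.* j
  neg-*-neg i j = solve (i ∷ j ∷ [])

denominator-clears : ∀ q → q * ι (+ ↧ₙ q) ≡ ι (↥ q)
denominator-clears q@(mkℚ n d _) = ≃-ι n (begin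
  toℚᵘ (q * ι (+ suc d))               ≈⟨ toℚᵘ-homo-* q (ι (+ suc d)) ⟩
  mkℚᵘ n d ℚᵘ.* toℚᵘ (ι (+ suc d))     ≈⟨ ℚᵘP.*-congˡ {mkℚᵘ n d} (toℚᵘ-ι (+ suc d)) ⟩
  mkℚᵘ n d ℚᵘ.* mkℚᵘ (+ suc d) 0       ≈⟨ *≡* cross ⟩
  mkℚᵘ n 0                             ∎)
  where
  open ℚᵘP.≃-Reasoning
  cross : n ℤ.* + suc d ℤ.* 1ℤ ≡ n ℤ.* + suc (d ℕ.* 1)
  cross rewrite ℕP.*-identityʳ d = ℤP.*-identityʳ _

denominator-one : ∀ q → ↧ₙ q ≡ 1 → q ≡ ι (↥ q)
denominator-one (mkℚ n 0 _) _ = toℚᵘ-injective (ℚᵘP.≃-sym (toℚᵘ-ι n))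

renameT : ∀ {n k} → (Fin n → Fin k) → Term n → Term k
renameT f (var i) = var (f i)
renameT f zer     = zer
renameT f one     = one
renameT f (s ⊕ t) = renameT f s ⊕ renameT f t
renameT f (s ⊗ t) = renameT f s ⊗ renameT f t

renameQF : ∀ {n k} → (Fin n → Fin k) → QF n → QF k
renameQF f (s ≐ t)  = renameT f s ≐ renameT f t
renameQF f (¬' φ)   = ¬' renameQF f φ
renameQF f (φ ∧' ψ) = renameQF f φ ∧' renameQF f ψ
renameQF f (φ ∨' ψ) = renameQF f φ ∨' renameQF f ψ

evalT-rename : ∀ {n k} (f : Fin n → Fin k) {ρ σ} → (∀ i → ρ (f i) ≡ σ i) →
  ∀ t → evalT (renameT f t) ρ ≡ evalT t σ
evalT-rename f agree (var i) = agree i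
evalT-rename f agree zer     = refl
evalT-rename f agree one     = refl
evalT-rename f agree (s ⊕ t) = cong₂ _+_ (evalT-rename f agree s) (evalT-rename f agree t)
evalT-rename f agree (s ⊗ t) = cong₂ _*_ (evalT-rename f agree s) (evalT-rename f agree t)

sat-rename : ∀ {n k} (f : Fin n → Fin k) {ρ σ} → (∀ i → ρ (f i) ≡ σ i) →
  ∀ φ → Sat (renameQF f φ) ρ ⇔ Sat φ σ
sat-rename f agree (s ≐ t)  = mk⇔ (λ e → trans (sym (ev s)) (trans e (ev t)))
                                  (λ e → trans (ev s) (trans e (sym (ev t))))
  where ev = evalT-rename f agree
sat-rename f agree (¬' φ)   = ¬-cong-⇔ (sat-rename f agree φ)
sat-rename f agree (φ ∧' ψ) = sat-rename f agree φ ×-⇔ sat-rename f agree ψ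
sat-rename f agree (φ ∨' ψ) = sat-rename f agree φ ⊎-⇔ sat-rename f agree ψ

⋀ : ∀ {k n} → (Fin k → QF n) → QF n
⋀ {zero}  ψ = zer ≐ zer
⋀ {suc k} ψ = ψ zero ∧' ⋀ (ψ ∘ suc)

sat-⋀ : ∀ {k n} (ψ : Fin k → QF n) ρ → Sat (⋀ ψ) ρ ⇔ (∀ i → Sat (ψ i) ρ)
sat-⋀ {zero}  ψ ρ = mk⇔ (λ _ ()) (λ _ → refl)
sat-⋀ {suc k} ψ ρ = mk⇔
  (λ { (here , rest) zero → here ; (here , rest) (suc i) → to (sat-⋀ (ψ ∘ suc) ρ) rest i })
  (λ all → all zero , from (sat-⋀ (ψ ∘ suc) ρ) (all ∘ suc))

concat-combine : ∀ {k m} (W : Vector (Vector ℚ m) k) i j → concat W (combine i j) ≡ W i j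
concat-combine W i j = cong (uncurry W) (remQuot-combine i j)

RelExists : (ℚ → Set) → (k : ℕ) → QF (suc k) → ℚ → Set
RelExists S k θ q = Σ (Vector ℚ k) λ ys → (∀ i → S (ys i)) × Sat θ (cons q ys)

-- If S = {y | ∃ w̄. φ(y, w̄)} then RelExists S k θ is defined by
--   ∃ ȳ w̄₁ … w̄ₖ. φ(y₁, w̄₁) ∧ … ∧ φ(yₖ, w̄ₖ) ∧ θ(x, ȳ).
-- The quantified variables are y₁ … yₖ followed by the blocks w̄ᵢ, the
-- j-th witness of block i sitting at position combine i j.
relExists-definable : ∀ {S} → ExistentiallyDefinable S →
  ∀ k θ → ExistentiallyDefinable (RelExists S k θ)
relExists-definable {S} (m , φ , defS) k θ = k ℕ.+ k ℕ.* m , Φ , λ q → mk⇔ (encode q) (decode q)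
  where
  yVar : Fin (suc k) → Fin (suc (k ℕ.+ k ℕ.* m))
  yVar zero    = zero
  yVar (suc i) = suc (i ↑ˡ k ℕ.* m)

  block : Fin k → Fin (suc m) → Fin (suc (k ℕ.+ k ℕ.* m))
  block i zero    = suc (i ↑ˡ k ℕ.* m)
  block i (suc j) = suc (k ↑ʳ combine i j)

  Φ : QF (suc (k ℕ.+ k ℕ.* m))
  Φ = ⋀ (λ i → renameQF (block i) φ) ∧' renameQF yVar θ

  encode : ∀ q → RelExists S k θ q → Σ (Vector ℚ (k ℕ.+ k ℕ.* m)) λ zs → Sat Φ (cons q zs)
  encode q (ys , inS , θ-holds) = zs , from (sat-⋀ _ _) blocks , from (sat-rename yVar agreeY θ) θ-holds
    where
    W : Vector (Vector ℚ m) k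
    W i = proj₁ (to (defS (ys i)) (inS i))
    zs : Vector ℚ (k ℕ.+ k ℕ.* m)
    zs = ys ++ᵛ concat W
    agreeY : ∀ i → cons q zs (yVar i) ≡ cons q ys i
    agreeY zero    = refl
    agreeY (suc i) = lookup-++ˡ ys (concat W) i
    agreeBlock : ∀ i j → cons q zs (block i j) ≡ cons (ys i) (W i) j
    agreeBlock i zero    = lookup-++ˡ ys (concat W) i
    agreeBlock i (suc j) = trans (lookup-++ʳ ys (concat W) (combine i j)) (concat-combine W i j)
    blocks : ∀ i → Sat (renameQF (block i) φ) (cons q zs)
    blocks i = from (sat-rename (block i) (agreeBlock i) φ) (proj₂ (to (defS (ys i)) (inS i)))

  decode : ∀ q → Σ (Vector ℚ (k ℕ.+ k ℕ.* m)) (λ zs → Sat Φ (cons q zs)) → RelExists S k θ q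
  decode q (zs , blocks , θ-holds) = ys , inS , to (sat-rename yVar agreeY θ) θ-holds
    where
    ys : Vector ℚ k
    ys i = zs (i ↑ˡ k ℕ.* m)
    agreeY : ∀ i → cons q zs (yVar i) ≡ cons q ys i
    agreeY zero    = refl
    agreeY (suc i) = refl
    agreeBlock : ∀ i j → cons q zs (block i j) ≡ cons (ys i) (λ j → zs (k ↑ʳ combine i j)) j
    agreeBlock i zero    = refl
    agreeBlock i (suc j) = refl
    inS : ∀ i → S (ys i)
    inS i = from (defS (ys i))
      (_ , to (sat-rename (block i) (agreeBlock i) φ) (to (sat-⋀ _ _) blocks i))

-- Part 3 (logic): ¬ ∃w̄. φ is equivalent to ∀w̄. ¬ φ, so complements of
-- ∃-definable sets are ∀-definable.

complement-universal : ∀ {S T : ℚ → Set} → ExistentiallyDefinable T →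
  (∀ q → S q ⇔ (¬ T q)) → UniversallyDefinable S
complement-universal (m , φ , defT) S⇔¬T =
  m , ¬' φ , λ q → ⇔.trans (S⇔¬T q) (⇔.trans (¬-cong-⇔ (defT q)) ¬∃⇔∀¬)
  where
  ¬∃⇔∀¬ : ∀ {P : Vector ℚ m → Set} → (¬ Σ _ P) ⇔ (∀ ys → ¬ P ys)
  ¬∃⇔∀¬ = mk⇔ (λ ¬∃ ys p → ¬∃ (ys , p)) (λ ∀¬ (ys , p) → ∀¬ ys p)

properFractionFormula : QF 5
properFractionFormula = ((x ⊗ b) ≐ a) ∧' ((((a ⊗ u) ⊕ (b ⊗ v)) ≐ one) ∧' (¬' ((b ⊗ b) ≐ one)))
  where
  x a b u v : Term 5
  x = var 0F
  a = var 1F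
  b = var 2F
  u = var 3F
  v = var 4F

ProperFraction : ℚ → Set
ProperFraction = RelExists IsInteger 4 properFractionFormula

integer⇒¬properFraction : ∀ q → IsInteger q → ¬ ProperFraction q
integer⇒¬properFraction q q∈ℤ (ys , integral , xb≡a , au+bv≡1 , b²≢1) =
  b²≢1 (unit q∈ℤ (integral 0F) (integral 1F) (integral 2F) (integral 3F) xb≡a au+bv≡1)
  where
  unit : ∀ {x a b u v} → IsInteger x → IsInteger a → IsInteger b → IsInteger u → IsInteger v →
    x * b ≡ a → a * u + b * v ≡ 1ℚ → b * b ≡ 1ℚ
  unit (x , refl) (a , refl) (b , refl) (u , refl) (v , refl) xb≡a au+bv≡1 =
    trans (ι-* b b) (cong ι (integral-fraction-unit x a b u v
      (ι-injective (trans (sym (ι-* x b)) xb≡a))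
      (ι-injective (trans (sym (ι-bézout a b u v)) au+bv≡1))))

-- A rational whose reduced denominator is not 1 is a proper fraction, with
-- its numerator and denominator as a, b and Bézout coefficients as u, v.
nonintegral⇒properFraction : ∀ q → ↧ₙ q ≢ 1 → ProperFraction q
nonintegral⇒properFraction q den≢1 with u , v , bézout ← numerator-denominator-bézout q =
  ι ∘ zs , (λ i → zs i , refl) , denominator-clears q ,
  trans (ι-bézout (↥ q) den u v) (cong ι bézout) , den≢1 ∘ square-one
  where
  den : ℤ
  den = + ↧ₙ q
  zs : Vector ℤ 4
  zs = ↥ q ∷ᵛ den ∷ᵛ u ∷ᵛ v ∷ᵛ []ᵛ
  square-one : ι den * ι den ≡ 1ℚ → ↧ₙ q ≡ 1
  square-one d²≡1 = ℕP.m*n≡1⇒m≡1 (↧ₙ q) (↧ₙ q)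
    (ℤP.+-injective (trans (ℤP.pos-* (↧ₙ q) (↧ₙ q)) (ι-injective (trans (sym (ι-* den den)) d²≡1))))

integer⇔¬properFraction : ∀ q → IsInteger q ⇔ (¬ ProperFraction q)
integer⇔¬properFraction q = mk⇔ (integer⇒¬properFraction q) integer-by-denominator
  where
  integer-by-denominator : ¬ ProperFraction q → IsInteger q
  integer-by-denominator ¬proper with ↧ₙ q ℕ.≟ 1
  ... | yes den≡1 = ↥ q , denominator-one q den≡1
  ... | no den≢1  = ⊥-elim (¬proper (nonintegral⇒properFraction q den≢1))

mainTheorem11 : ExistentiallyDefinable IsInteger → UniversallyDefinable IsInteger
mainTheorem11 ∃-def-ℤ = complement-universal properFractions-∃-definable integer⇔¬properFraction
  where
  properFractions-∃-definable : ExistentiallyDefinable ProperFraction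
  properFractions-∃-definable = relExists-definable ∃-def-ℤ 4 properFractionFormula
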